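{- Let $H$ be a graph with vertex set $\{v_1,\dots,v_{n(H)}\}$, let $\mathcal{X}=\{X_i:1\le i\le n(H)\}$ be a family of graphs, each with at least one vertex, and let $G=H\circ\mathcal{X}$. Then $G$ is a König–Egerváry graph if and only if each $X_i$ is a König–Egerváry graph without a perfect matching.
   Context: All graphs are finite, simple and undirected. $n(G)$ is the number of vertices, $\alpha(G)$ the independence number and $\mu(G)$ the maximum matching size of $G$. A graph $G$ is König–Egerváry if $\alpha(G)+\mu(G)=n(G)$. The corona $H\circ\mathcal{X}$ is obtained from the disjoint union of $H$ and $X_1,\dots,X_{n(H)}$ by joining each vertex $v_i$ of $H$ to all vertices of $X_i$. -}

module Defs where

open import Data.Nat using (ℕ; zero; suc; _+_; _*_; _≤_)
open import Data.Fin using (Fin; zero; suc; splitAt)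
open import Data.Fin.Subset using (Subset; _∈_; ∣_∣)
open import Data.Bool using (Bool; true; false)
open import Data.Product using (Σ; ∃; _×_; _,_; proj₁; proj₂)
open import Data.Sum using (_⊎_; inj₁; inj₂)
open import Data.List using (List; []; _∷_; length; concatMap)
open import Data.List.Relation.Unary.All using (All)
open import Data.List.Relation.Unary.Unique.Propositional using (Unique)
open import Relation.Binary.PropositionalEquality using (_≡_; refl; sym)

record Graph : Set where
  field
    n       : ℕ
    adj     : Fin n → Fin n → Bool
    adj-sym : ∀ i j → adj i j ≡ adj j i
    adj-irr : ∀ i → adj i i ≡ false
open Graph public

IsIndependent : (G : Graph) → Subset (n G) → Set
IsIndependent G S = ∀ i j → i ∈ S → j ∈ S → adj G i j ≡ false

IsIndependenceNumber : Graph → ℕ → Set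
IsIndependenceNumber G a =
  (Σ (Subset (n G)) λ S → IsIndependent G S × ∣ S ∣ ≡ a)
  × (∀ S → IsIndependent G S → ∣ S ∣ ≤ a)

endpoints : {m : ℕ} → List (Fin m × Fin m) → List (Fin m)
endpoints = concatMap (λ e → proj₁ e ∷ proj₂ e ∷ [])

IsMatching : (G : Graph) → List (Fin (n G) × Fin (n G)) → Set
IsMatching G M = All (λ e → adj G (proj₁ e) (proj₂ e) ≡ true) M
               × Unique (endpoints M)

IsMatchingNumber : Graph → ℕ → Set
IsMatchingNumber G m =
  (Σ (List (Fin (n G) × Fin (n G))) λ M → IsMatching G M × length M ≡ m)
  × (∀ M → IsMatching G M → length M ≤ m)

IsKE : Graph → Set
IsKE G = Σ ℕ λ a → Σ ℕ λ m →
  IsIndependenceNumber G a × IsMatchingNumber G m × a + m ≡ n G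

HasPerfectMatching : Graph → Set
HasPerfectMatching G = Σ (List (Fin (n G) × Fin (n G))) λ M →
  IsMatching G M × 2 * length M ≡ n G

-- Corona H ∘ X.
-- Vertices of the corona: Fin (n H + total (n H) (λ i → n (X i))),
-- the first n H are the vertices v_i of H, then the vertices of X_0,
-- X_1, ... in order.

total : (k : ℕ) → (Fin k → ℕ) → ℕ
total zero    f = 0
total (suc k) f = f zero + total k (λ i → f (suc i))

dsplit : (k : ℕ) (f : Fin k → ℕ) → Fin (total k f) → Σ (Fin k) (λ i → Fin (f i))
dsplit zero    f ()
dsplit (suc k) f x with splitAt (f zero) x
... | inj₁ y = zero , y
... | inj₂ y with dsplit k (λ i → f (suc i)) y
...   | (i , z) = suc i , z

CVert : (H : Graph) → (Fin (n H) → Graph) → Set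
CVert H X = Fin (n H) ⊎ Σ (Fin (n H)) (λ i → Fin (n (X i)))

decode : (H : Graph) (X : Fin (n H) → Graph) →
         Fin (n H + total (n H) (λ i → n (X i))) → CVert H X
decode H X x with splitAt (n H) x
... | inj₁ v = inj₁ v
... | inj₂ y = inj₂ (dsplit (n H) (λ i → n (X i)) y)

open import Data.Fin using (_≟_)
open import Relation.Nullary using (yes; no)

cadj : (H : Graph) (X : Fin (n H) → Graph) → CVert H X → CVert H X → Bool
cadj H X (inj₁ u) (inj₁ v) = adj H u v
cadj H X (inj₁ u) (inj₂ (j , y)) with u ≟ j
... | yes _ = true
... | no  _ = false
cadj H X (inj₂ (i , x)) (inj₁ v) with i ≟ v
... | yes _ = true
... | no  _ = false
cadj H X (inj₂ (i , x)) (inj₂ (j , y)) with i ≟ j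
... | yes refl = adj (X i) x y
... | no  _    = false

open import Relation.Nullary using (¬_)
open import Data.Empty using (⊥-elim)

cadj-sym : (H : Graph) (X : Fin (n H) → Graph) (a b : CVert H X) →
           cadj H X a b ≡ cadj H X b a
cadj-sym H X (inj₁ u) (inj₁ v) = adj-sym H u v
cadj-sym H X (inj₁ u) (inj₂ (j , y)) with u ≟ j | j ≟ u
... | yes _  | yes _ = refl
... | yes p  | no ¬q = ⊥-elim (¬q (sym p))
... | no ¬p  | yes q = ⊥-elim (¬p (sym q))
... | no _   | no _  = refl
cadj-sym H X (inj₂ (i , x)) (inj₁ v) with i ≟ v | v ≟ i
... | yes _  | yes _ = refl
... | yes p  | no ¬q = ⊥-elim (¬q (sym p))
... | no ¬p  | yes q = ⊥-elim (¬p (sym q))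
... | no _   | no _  = refl
cadj-sym H X (inj₂ (i , x)) (inj₂ (j , y)) with i ≟ j | j ≟ i
... | yes refl | yes refl = adj-sym (X i) x y
... | yes refl | no ¬q = ⊥-elim (¬q refl)
... | no ¬p  | yes refl = ⊥-elim (¬p refl)
... | no _   | no _  = refl

cadj-irr : (H : Graph) (X : Fin (n H) → Graph) (a : CVert H X) →
           cadj H X a a ≡ false
cadj-irr H X (inj₁ u) = adj-irr H u
cadj-irr H X (inj₂ (i , x)) with i ≟ i
... | yes refl = adj-irr (X i) x
... | no ¬p = ⊥-elim (¬p refl)

corona : (H : Graph) → (Fin (n H) → Graph) → Graph
corona H X = record
  { n       = n H + total (n H) (λ i → n (X i))
  ; adj     = λ a b → cadj H X (decode H X a) (decode H X b)
  ; adj-sym = λ a b → cadj-sym H X (decode H X a) (decode H X b)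
  ; adj-irr = λ a → cadj-irr H X (decode H X a)
  }

{-# OPTIONS --safe #-}
-- A graph is König–Egerváry iff it has an independent set S and a matching M such
-- that M matches every vertex outside S to a vertex of S.  Indeed S followed by the
-- endpoint outside S of each edge of M is a list without repetitions, so
-- |S| + |M| ≤ n always, with equality exactly when that list exhausts the vertices.
--
-- (⇐) Take such certificates (Sᵢ, Mᵢ) for the Xᵢ.  As Xᵢ has no perfect matching,
-- Mᵢ misses a vertex xᵢ, which then lies in Sᵢ; the union of the Sᵢ together with
-- the union of the Mᵢ and of the edges vᵢxᵢ is a certificate for H ∘ X.
--
-- (⇒) Take a certificate (S, M) for H ∘ X and fix zᵢ ∈ Xᵢ.  Replacing every hub
-- vᵢ ∈ S by zᵢ gives an independent set S′ avoiding H with |S′| ≥ |S|, so (S′, M)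
-- is a certificate as well.  Its trace on Xᵢ is a certificate for Xᵢ, and the partner
-- of vᵢ, which lies in Xᵢ ∩ S′, is missed by the trace of M; since the matching of a
-- certificate is maximum, Xᵢ has no perfect matching.
module Submission where

open import Defs
open import Data.Nat using (ℕ; _≥_)
open import Data.Fin using (Fin)
open import Data.Product using (_×_)
open import Relation.Nullary using (¬_)
open import Function.Bundles using (_⇔_)

open import Data.Bool using (true; false; if_then_else_)
open import Data.Bool.Properties using (¬-not)
open import Data.Empty using (⊥-elim)
open import Data.Fin using (zero; suc; _≟_; fromℕ<; _↑ˡ_; _↑ʳ_; splitAt; join)
open import Data.Fin.Properties
  using (suc-injective; any?; splitAt-↑ˡ; splitAt-↑ʳ; splitAt⁻¹-↑ˡ; splitAt⁻¹-↑ʳ)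
open import Data.Fin.Subset using (Subset; ∣_∣) renaming (_∈_ to _∈ₛ_; _∉_ to _∉ₛ_)
open import Data.Fin.Subset.Properties using () renaming (_∈?_ to _∈ₛ?_)
open import Data.List using (List; []; _∷_; length; map; _++_; allFin; mapMaybe; concat; tabulate)
open import Data.List.Membership.Propositional using (_∈_; _∉_)
open import Data.List.Membership.Propositional.Properties
  using (∈-concat⁺′; ∈-tabulate⁺; ∈-∃++; ∈-++⁺ˡ; ∈-++⁺ʳ; ∈-++⁻; ∈-map⁺; ∈-map⁻; ∈-allFin)
open import Data.List.Properties using (length-++; length-map; length-tabulate; concatMap-++; map-tabulate)
open import Data.List.Relation.Binary.Disjoint.Propositional using (Disjoint)
open import Data.List.Relation.Binary.Subset.Propositional using (_⊆_)
open import Data.List.Relation.Unary.All as All using (_∷_)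
open import Data.List.Relation.Unary.All.Properties using (¬Any⇒All¬; All¬⇒¬Any)
  renaming (map⁺ to All-map⁺; tabulate⁺ to All-tabulate⁺; concat⁺ to All-concat⁺)
import Data.List.Relation.Unary.AllPairs.Properties as AllPairs
open import Data.List.Relation.Unary.Any using (here; there) renaming (any? to anyˡ?)
open import Data.List.Relation.Unary.Unique.Propositional using (Unique; []; _∷_)
import Data.List.Relation.Unary.Unique.Propositional.Properties as Unique
open import Data.Maybe using (Maybe; just; nothing)
open import Data.Nat using (suc; _+_; _*_; _≤_; _<_; z≤n; s≤s)
open import Data.Nat.Properties
  using ( +-suc; *-suc; +-monoˡ-≤; *-monoʳ-≤; +-cancelʳ-≤; +-cancelˡ-≤
        ; ≤-antisym; ≤-reflexive; ≤∧≢⇒<; <⇒≱; module ≤-Reasoning)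
open import Data.Product using (Σ; ∃; ∃₂; _,_; proj₁; proj₂)
open import Data.Sum as Sum using (_⊎_; inj₁; inj₂; swap)
open import Data.Vec using ([]; _∷_)
import Data.Vec as Vec
open import Data.Vec.Properties using (lookup∘tabulate; lookup⇒[]=; []=⇒lookup)
open import Function using (_∘_; case_of_)
open import Function.Bundles using (mk⇔)
open import Level using (Level)
open import Relation.Binary.PropositionalEquality
  using (_≡_; _≢_; refl; sym; trans; cong; cong₂; subst; subst₂; module ≡-Reasoning)
open import Relation.Nullary using (Dec; yes; no; ¬?; contradiction; _×-dec_)
open import Relation.Nullary.Decidable using (does; decidable-stable; dec-true)
open import Relation.Unary using (Pred; Decidable)

private
  variable
    ℓ : Level
    A : Set
    m : ℕ

_∈ˡ?_ : (x : Fin m) (xs : List (Fin m)) → Dec (x ∈ xs)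
x ∈ˡ? xs = anyˡ? (x ≟_) xs

length≤-⊆-Unique : {xs ys : List A} → Unique xs → xs ⊆ ys → length xs ≤ length ys
length≤-⊆-Unique {xs = []} _ _ = z≤n
length≤-⊆-Unique {xs = x ∷ xs} (x∉xs ∷ xs!) xs⊆ys with ∈-∃++ (xs⊆ys (here refl))
... | as , bs , refl = begin
  suc (length xs)              ≤⟨ s≤s (length≤-⊆-Unique xs! xs⊆as++bs) ⟩
  suc (length (as ++ bs))      ≡⟨ cong suc (length-++ as) ⟩
  suc (length as + length bs)  ≡⟨ +-suc (length as) (length bs) ⟨
  length as + length (x ∷ bs)  ≡⟨ length-++ as ⟨
  length (as ++ x ∷ bs)        ∎
  where
  open ≤-Reasoning
  xs⊆as++bs : xs ⊆ as ++ bs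
  xs⊆as++bs {z} z∈xs with ∈-++⁻ as (xs⊆ys (there z∈xs))
  ... | inj₁ z∈as         = ∈-++⁺ˡ z∈as
  ... | inj₂ (here refl)  = contradiction z∈xs (All¬⇒¬Any x∉xs)
  ... | inj₂ (there z∈bs) = ∈-++⁺ʳ as z∈bs

Unique-map⁺-on : {B : Set} {f : A → B} {xs : List A} →
                 (∀ {x y} → x ∈ xs → y ∈ xs → f x ≡ f y → x ≡ y) → Unique xs → Unique (map f xs)
Unique-map⁺-on inj []           = []
Unique-map⁺-on {f = f} {x ∷ xs} inj (x∉xs ∷ xs!) =
  ¬Any⇒All¬ _ fx∉ ∷ Unique-map⁺-on (λ x∈ y∈ → inj (there x∈) (there y∈)) xs!
  where
  fx∉ : f x ∉ map f xs
  fx∉ fx∈ with y , y∈xs , fx≡fy ← ∈-map⁻ f fx∈ =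
    All¬⇒¬Any x∉xs (subst (_∈ xs) (sym (inj (here refl) (there y∈xs) fx≡fy)) y∈xs)

length-allFin : ∀ m → length (allFin m) ≡ m
length-allFin m = length-tabulate (λ z → z)

Unique⇒length≤ : {xs : List (Fin m)} → Unique xs → length xs ≤ m
Unique⇒length≤ {m} {xs} xs! =
  subst (length xs ≤_) (length-allFin m) (length≤-⊆-Unique xs! (λ {z} _ → ∈-allFin z))

∀∈⇒length≥ : {xs : List (Fin m)} → (∀ z → z ∈ xs) → m ≤ length xs
∀∈⇒length≥ {m} {xs} all∈ =
  subst (_≤ length xs) (length-allFin m) (length≤-⊆-Unique (Unique.allFin⁺ m) (λ {z} _ → all∈ z))

Unique∧length≥⇒∀∈ : {xs : List (Fin m)} → Unique xs → m ≤ length xs → ∀ z → z ∈ xs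
Unique∧length≥⇒∀∈ {xs = xs} xs! m≤∣xs∣ z with z ∈ˡ? xs
... | yes z∈xs = z∈xs
... | no  z∉xs = contradiction m≤∣xs∣ (<⇒≱ (Unique⇒length≤ (¬Any⇒All¬ xs z∉xs ∷ xs!)))

length<⇒∃∉ : {xs : List (Fin m)} → length xs < m → ∃ λ z → z ∉ xs
length<⇒∃∉ {xs = xs} ∣xs∣<m with any? (λ z → ¬? (z ∈ˡ? xs))
... | yes missing = missing
... | no  ¬missing = contradiction (∀∈⇒length≥ all∈) (<⇒≱ ∣xs∣<m)
  where
  all∈ : ∀ z → z ∈ xs
  all∈ z = decidable-stable (z ∈ˡ? xs) (λ z∉xs → ¬missing (z , z∉xs))

decSubset : {P : Pred (Fin m) ℓ} → Decidable P → Subset m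
decSubset P? = Vec.tabulate (λ x → does (P? x))

∈-decSubset⁺ : {P : Pred (Fin m) ℓ} (P? : Decidable P) {x : Fin m} → P x → x ∈ₛ decSubset P?
∈-decSubset⁺ P? {x} px = lookup⇒[]= x _ (trans (lookup∘tabulate _ x) (dec-true (P? x) px))

∈-decSubset⁻ : {P : Pred (Fin m) ℓ} (P? : Decidable P) {x : Fin m} → x ∈ₛ decSubset P? → P x
∈-decSubset⁻ P? {x} x∈ with P? x | trans (sym (lookup∘tabulate _ x)) ([]=⇒lookup x∈)
... | yes px | _  = px
... | no  _  | ()

elements : Subset m → List (Fin m)
elements []          = []
elements (true  ∷ p) = zero ∷ map suc (elements p)
elements (false ∷ p) = map suc (elements p)

length-elements : (p : Subset m) → length (elements p) ≡ ∣ p ∣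
length-elements []          = refl
length-elements (true  ∷ p) = cong suc (trans (length-map suc (elements p)) (length-elements p))
length-elements (false ∷ p) = trans (length-map suc (elements p)) (length-elements p)

∈-elements⁺ : {p : Subset m} {x : Fin m} → x ∈ₛ p → x ∈ elements p
∈-elements⁺ {p = true  ∷ p} Vec.here          = here refl
∈-elements⁺ {p = true  ∷ p} (Vec.there x∈p) = there (∈-map⁺ suc (∈-elements⁺ x∈p))
∈-elements⁺ {p = false ∷ p} (Vec.there x∈p) = ∈-map⁺ suc (∈-elements⁺ x∈p)

∈-elements⁻ : {p : Subset m} {x : Fin m} → x ∈ elements p → x ∈ₛ p
∈-elements⁻ {p = true  ∷ p} (here refl) = Vec.here
∈-elements⁻ {p = true  ∷ p} (there x∈) with ∈-map⁻ suc x∈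
... | _ , y∈ , refl = Vec.there (∈-elements⁻ y∈)
∈-elements⁻ {p = false ∷ p} x∈ with ∈-map⁻ suc x∈
... | _ , y∈ , refl = Vec.there (∈-elements⁻ y∈)

elements-Unique : (p : Subset m) → Unique (elements p)
elements-Unique []          = []
elements-Unique (true  ∷ p) =
  All-map⁺ (All.universal (λ _ ()) _) ∷ Unique.map⁺ suc-injective (elements-Unique p)
elements-Unique (false ∷ p) = Unique.map⁺ suc-injective (elements-Unique p)

module _ {m′ : ℕ} (f : Fin m → Fin m′) (S : Subset m) where

  private
    image? : Decidable (λ y → ∃ λ x → x ∈ₛ S × f x ≡ y)
    image? y = any? (λ x → (x ∈ₛ? S) ×-dec (f x ≟ y))

  image : Subset m′
  image = decSubset image?

  ∈-image⁺ : ∀ {x} → x ∈ₛ S → f x ∈ₛ image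
  ∈-image⁺ x∈S = ∈-decSubset⁺ image? (_ , x∈S , refl)

  ∈-image⁻ : ∀ {y} → y ∈ₛ image → ∃ λ x → x ∈ₛ S × f x ≡ y
  ∈-image⁻ = ∈-decSubset⁻ image?

  ∣image∣≥ : (∀ {x y} → x ∈ₛ S → y ∈ₛ S → f x ≡ f y → x ≡ y) → ∣ S ∣ ≤ ∣ image ∣
  ∣image∣≥ inj =
    subst₂ _≤_ (trans (length-map f (elements S)) (length-elements S)) (length-elements image)
      (length≤-⊆-Unique (Unique-map⁺-on (λ x∈ y∈ → inj (∈-elements⁻ x∈) (∈-elements⁻ y∈)) (elements-Unique S))
                        f[S]⊆image)
    where
    f[S]⊆image : map f (elements S) ⊆ elements image
    f[S]⊆image fx∈ with x , x∈ , refl ← ∈-map⁻ f fx∈ = ∈-elements⁺ (∈-image⁺ (∈-elements⁻ x∈))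

Edge : ℕ → Set
Edge m = Fin m × Fin m

_∈ᵉ_ : Fin m → Edge m → Set
v ∈ᵉ e = v ≡ proj₁ e ⊎ v ≡ proj₂ e

MatchedTo : List (Edge m) → Fin m → Fin m → Set
MatchedTo M v w = (v , w) ∈ M ⊎ (w , v) ∈ M

module _ where
  private
    variable
      u v w : Fin m
      e e′ : Edge m
      M : List (Edge m)

  ∈-endpoints⁺ : e ∈ M → v ∈ᵉ e → v ∈ endpoints M
  ∈-endpoints⁺ (here refl) (inj₁ refl) = here refl
  ∈-endpoints⁺ (here refl) (inj₂ refl) = there (here refl)
  ∈-endpoints⁺ (there e∈M) v∈e        = there (there (∈-endpoints⁺ e∈M v∈e))

  ∈-endpoints⁻ : ∀ M → v ∈ endpoints M → ∃ λ e → e ∈ M × v ∈ᵉ e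
  ∈-endpoints⁻ (e ∷ M) (here v≡)          = e , here refl , inj₁ v≡
  ∈-endpoints⁻ (e ∷ M) (there (here v≡))  = e , here refl , inj₂ v≡
  ∈-endpoints⁻ (e ∷ M) (there (there v∈)) with ∈-endpoints⁻ M v∈
  ... | e′ , e′∈M , v∈e′ = e′ , there e′∈M , v∈e′

  length-endpoints : (M : List (Edge m)) → length (endpoints M) ≡ 2 * length M
  length-endpoints []      = refl
  length-endpoints (e ∷ M) = trans (cong (2 +_) (length-endpoints M)) (sym (*-suc 2 (length M)))

  MatchedTo-sym : MatchedTo M v w → MatchedTo M w v
  MatchedTo-sym = swap

  MatchedTo⇒∈endpoints : MatchedTo M v w → v ∈ endpoints M
  MatchedTo⇒∈endpoints (inj₁ vw∈M) = ∈-endpoints⁺ vw∈M (inj₁ refl)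
  MatchedTo⇒∈endpoints (inj₂ wv∈M) = ∈-endpoints⁺ wv∈M (inj₂ refl)

  endpoint∉rest : Unique (endpoints (e ∷ M)) → v ∈ᵉ e → v ∉ endpoints M
  endpoint∉rest (a∉ ∷ _)      (inj₁ refl) v∈ = All¬⇒¬Any a∉ (there v∈)
  endpoint∉rest (_ ∷ b∉ ∷ _) (inj₂ refl) v∈ = All¬⇒¬Any b∉ v∈

  endpoints-distinct : Unique (endpoints (e ∷ M)) → proj₁ e ≢ proj₂ e
  endpoints-distinct (a∉ ∷ _) a≡b = All¬⇒¬Any a∉ (here a≡b)

  matching-edge-unique : Unique (endpoints M) → e ∈ M → e′ ∈ M → v ∈ᵉ e → v ∈ᵉ e′ → e ≡ e′
  matching-edge-unique M! (here refl) (here refl)   _    _     = refl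
  matching-edge-unique {M = _ ∷ M} M! (here refl) (there e′∈M) v∈e v∈e′ =
    contradiction (∈-endpoints⁺ e′∈M v∈e′) (endpoint∉rest {M = M} M! v∈e)
  matching-edge-unique {M = _ ∷ M} M! (there e∈M) (here refl)  v∈e v∈e′ =
    contradiction (∈-endpoints⁺ e∈M v∈e) (endpoint∉rest {M = M} M! v∈e′)
  matching-edge-unique (_ ∷ _ ∷ M!) (there e∈M) (there e′∈M) = matching-edge-unique M! e∈M e′∈M

  endpoints-concat : (Ms : List (List (Edge m))) → endpoints (concat Ms) ≡ concat (map endpoints Ms)
  endpoints-concat []       = refl
  endpoints-concat (M ∷ Ms) =
    trans (concatMap-++ _ M (concat Ms)) (cong (endpoints M ++_) (endpoints-concat Ms))

  blockwise-Unique : {k : ℕ} (B : Fin k → List (Edge m)) (block : Fin m → Fin k) →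
                     (∀ i → Unique (endpoints (B i))) →
                     (∀ i {v} → v ∈ endpoints (B i) → block v ≡ i) →
                     Unique (endpoints (concat (tabulate B)))
  blockwise-Unique B block B! B-in-block =
    subst Unique (sym (trans (endpoints-concat (tabulate B)) (cong concat (map-tabulate B endpoints))))
      (Unique.concat⁺ (All-tabulate⁺ B!) (AllPairs.tabulate⁺ disjoint))
    where
    disjoint : ∀ {i j} → i ≢ j → Disjoint (endpoints (B i)) (endpoints (B j))
    disjoint i≢j (v∈i , v∈j) = i≢j (trans (sym (B-in-block _ v∈i)) (B-in-block _ v∈j))

  MatchedTo⇒adj : (G : Graph) {M : List (Edge (n G))} {v w : Fin (n G)} →
                  IsMatching G M → MatchedTo M v w → adj G v w ≡ true
  MatchedTo⇒adj G         (M-adj , _) (inj₁ vw∈M) = All.lookup M-adj vw∈M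
  MatchedTo⇒adj G {v = v} {w} (M-adj , _) (inj₂ wv∈M) = trans (adj-sym G v w) (All.lookup M-adj wv∈M)

  outsideEnd : Subset m → Edge m → Fin m
  outsideEnd S (u , w) = if does (u ∈ₛ? S) then w else u

  module _ {S : Subset m} where

    outsideEnd-∈ᵉ : (e : Edge m) → outsideEnd S e ∈ᵉ e
    outsideEnd-∈ᵉ (u , w) with u ∈ₛ? S
    ... | yes _ = inj₂ refl
    ... | no  _ = inj₁ refl

    outsideEnd-of-∈ : u ∈ₛ S → outsideEnd S (u , w) ≡ w
    outsideEnd-of-∈ {u} u∈S with u ∈ₛ? S
    ... | yes _   = refl
    ... | no  u∉S = contradiction u∈S u∉S

    outsideEnd-of-∉ : u ∉ₛ S → outsideEnd S (u , w) ≡ u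
    outsideEnd-of-∉ {u} u∉S with u ∈ₛ? S
    ... | yes u∈S = contradiction u∈S u∉S
    ... | no  _   = refl

    outsideEnds-Unique : Unique (endpoints M) → Unique (map (outsideEnd S) M)
    outsideEnds-Unique {M = []}    _  = []
    outsideEnds-Unique {M = e ∷ M} M! with _ ∷ _ ∷ rest! ← M! =
      ¬Any⇒All¬ _ fresh ∷ outsideEnds-Unique rest!
      where
      fresh : outsideEnd S e ∉ map (outsideEnd S) M
      fresh v∈ with ∈-map⁻ (outsideEnd S) v∈
      ... | e′ , e′∈M , same-end = endpoint∉rest {M = M} M! (outsideEnd-∈ᵉ e)
        (∈-endpoints⁺ e′∈M (subst (_∈ᵉ e′) (sym same-end) (outsideEnd-∈ᵉ e′)))

  outsideEnd-∉ : (G : Graph) {S : Subset (n G)} {u w : Fin (n G)} →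
                 IsIndependent G S → adj G u w ≡ true → outsideEnd S (u , w) ∉ₛ S
  outsideEnd-∉ G {S} {u} {w} S-indep uw with u ∈ₛ? S
  ... | no  u∉S = u∉S
  ... | yes u∈S = λ w∈S → contradiction (trans (sym uw) (S-indep u w u∈S w∈S)) λ ()

  coverList : Subset m → List (Edge m) → List (Fin m)
  coverList S M = elements S ++ map (outsideEnd S) M

  length-coverList : (S : Subset m) (M : List (Edge m)) → length (coverList S M) ≡ ∣ S ∣ + length M
  length-coverList S M = begin
    length (elements S ++ map (outsideEnd S) M)          ≡⟨ length-++ (elements S) ⟩
    length (elements S) + length (map (outsideEnd S) M)
      ≡⟨ cong₂ _+_ (length-elements S) (length-map _ M) ⟩
    ∣ S ∣ + length M                                      ∎
    where open ≡-Reasoning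

  adj⇒≢ : (G : Graph) {u w : Fin (n G)} → adj G u w ≡ true → u ≢ w
  adj⇒≢ G {u} uw refl = contradiction (trans (sym uw) (adj-irr G u)) λ ()

  MatchesInto : Subset m → List (Edge m) → Set
  MatchesInto S M = ∀ v → v ∉ₛ S → ∃ λ w → w ∈ₛ S × MatchedTo M v w

  MatchesInto⇒∀∈coverList : {S : Subset m} → MatchesInto S M → ∀ v → v ∈ coverList S M
  MatchesInto⇒∀∈coverList {S = S} matches v with v ∈ₛ? S
  ... | yes v∈S = ∈-++⁺ˡ (∈-elements⁺ v∈S)
  ... | no  v∉S with matches v v∉S
  ...   | w , w∈S , inj₁ vw∈M =
    ∈-++⁺ʳ (elements S) (subst (_∈ _) (outsideEnd-of-∉ v∉S) (∈-map⁺ _ vw∈M))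
  ...   | w , w∈S , inj₂ wv∈M =
    ∈-++⁺ʳ (elements S) (subst (_∈ _) (outsideEnd-of-∈ w∈S) (∈-map⁺ _ wv∈M))

  module _ (G : Graph) {S : Subset (n G)} {M : List (Edge (n G))}
           (S-indep : IsIndependent G S) (M-match : IsMatching G M) where

    coverList-Unique : Unique (coverList S M)
    coverList-Unique = Unique.++⁺ (elements-Unique S) (outsideEnds-Unique (proj₂ M-match)) disjoint
      where
      disjoint : ∀ {v} → ¬ (v ∈ elements S × v ∈ map (outsideEnd S) M)
      disjoint (v∈S , v∈ends) with ∈-map⁻ (outsideEnd S) v∈ends
      ... | _ , e∈M , refl =
        outsideEnd-∉ G S-indep (All.lookup (proj₁ M-match) e∈M) (∈-elements⁻ v∈S)

    weak-duality : ∣ S ∣ + length M ≤ n G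
    weak-duality = subst (_≤ n G) (length-coverList S M) (Unique⇒length≤ coverList-Unique)

    MatchesInto⇒tight : MatchesInto S M → ∣ S ∣ + length M ≡ n G
    MatchesInto⇒tight matches = ≤-antisym weak-duality
      (subst (n G ≤_) (length-coverList S M) (∀∈⇒length≥ (MatchesInto⇒∀∈coverList matches)))

    module _ (tight : n G ≤ ∣ S ∣ + length M) where

      outside⇒outsideEnd : v ∉ₛ S → v ∈ map (outsideEnd S) M
      outside⇒outsideEnd {v} v∉S with ∈-++⁻ (elements S) (all-listed v)
        where
        all-listed : ∀ v → v ∈ coverList S M
        all-listed =
          Unique∧length≥⇒∀∈ coverList-Unique (subst (n G ≤_) (sym (length-coverList S M)) tight)
      ... | inj₁ v∈S    = contradiction (∈-elements⁻ v∈S) v∉S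
      ... | inj₂ v∈ends = v∈ends

      matching-edge-meets-S : (u , w) ∈ M → u ∉ₛ S → w ∈ₛ S
      matching-edge-meets-S {u} {w} uw∈M u∉S with w ∈ₛ? S
      ... | yes w∈S = w∈S
      ... | no  w∉S with ∈-map⁻ (outsideEnd S) (outside⇒outsideEnd w∉S)
      ...   | e′ , e′∈M , w≡end with matching-edge-unique (proj₂ M-match) uw∈M e′∈M (inj₂ refl)
                                       (subst (_∈ᵉ e′) (sym w≡end) (outsideEnd-∈ᵉ e′))
      ...     | refl = ⊥-elim (adj⇒≢ G (All.lookup (proj₁ M-match) uw∈M) (sym w≡u))
        where
        w≡u : w ≡ u
        w≡u = trans w≡end (outsideEnd-of-∉ u∉S)

      tight⇒MatchesInto : MatchesInto S M
      tight⇒MatchesInto v v∉S with ∈-map⁻ (outsideEnd S) (outside⇒outsideEnd v∉S)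
      ... | (u , w) , uw∈M , refl with u ∈ₛ? S
      ...   | yes u∈S = u , u∈S , inj₂ uw∈M
      ...   | no  u∉S = w , matching-edge-meets-S uw∈M u∉S , inj₁ uw∈M

record KEWitness (G : Graph) : Set where
  field
    S           : Subset (n G)
    M           : List (Edge (n G))
    independent : IsIndependent G S
    matching    : IsMatching G M
    matchesInto : MatchesInto S M

IsKE⇒KEWitness : (G : Graph) → IsKE G → KEWitness G
IsKE⇒KEWitness G (_ , _ , ((S , S-indep , ∣S∣≡α) , _) , ((M , M-match , ∣M∣≡μ) , _) , α+μ≡n) = record
  { S           = S
  ; M           = M
  ; independent = S-indep
  ; matching    = M-match
  ; matchesInto = tight⇒MatchesInto G S-indep M-match (≤-reflexive (sym tight))
  }
  where
  tight : ∣ S ∣ + length M ≡ n G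
  tight = trans (cong₂ _+_ ∣S∣≡α ∣M∣≡μ) α+μ≡n

module KEWitnessProperties {G : Graph} (W : KEWitness G) where
  open KEWitness W

  tight : ∣ S ∣ + length M ≡ n G
  tight = MatchesInto⇒tight G independent matching matchesInto

  maximum-independent : ∀ {S′} → IsIndependent G S′ → ∣ S′ ∣ ≤ ∣ S ∣
  maximum-independent {S′} S′-indep = +-cancelʳ-≤ (length M) ∣ S′ ∣ ∣ S ∣
    (subst (∣ S′ ∣ + length M ≤_) (sym tight) (weak-duality G S′-indep matching))

  maximum-matching : ∀ {P} → IsMatching G P → length P ≤ length M
  maximum-matching {P} P-match = +-cancelˡ-≤ ∣ S ∣ (length P) (length M)
    (subst (∣ S ∣ + length P ≤_) (sym tight) (weak-duality G independent P-match))

  isKE : IsKE G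
  isKE = ∣ S ∣ , length M
       , ((S , independent , refl) , λ _ → maximum-independent)
       , ((M , matching , refl) , λ _ → maximum-matching)
       , tight

  unmatched⇒∈ : ∀ {v} → v ∉ endpoints M → v ∈ₛ S
  unmatched⇒∈ {v} v∉M with v ∈ₛ? S
  ... | yes v∈S = v∈S
  ... | no  v∉S = contradiction (MatchedTo⇒∈endpoints (proj₂ (proj₂ (matchesInto v v∉S)))) v∉M

  unmatched⇒¬perfect : ∀ {v} → v ∉ endpoints M → ¬ HasPerfectMatching G
  unmatched⇒¬perfect {v} v∉M (P , P-match , 2∣P∣≡n) = <⇒≱ 2∣M∣<n (begin
    n G            ≡⟨ 2∣P∣≡n ⟨
    2 * length P   ≤⟨ *-monoʳ-≤ 2 (maximum-matching P-match) ⟩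
    2 * length M   ∎)
    where
    open ≤-Reasoning
    2∣M∣<n : 2 * length M < n G
    2∣M∣<n = subst (λ k → suc k ≤ n G) (length-endpoints M)
               (Unique⇒length≤ (¬Any⇒All¬ _ v∉M ∷ proj₂ matching))

  ¬perfect⇒unmatched : ¬ HasPerfectMatching G → ∃ λ v → v ∉ endpoints M
  ¬perfect⇒unmatched ¬perfect = length<⇒∃∉ (subst (_< n G) (sym (length-endpoints M))
    (≤∧≢⇒< (subst (_≤ n G) (length-endpoints M) (Unique⇒length≤ (proj₂ matching)))
           (λ 2∣M∣≡n → ¬perfect (M , matching , 2∣M∣≡n))))

image-independent : {G G′ : Graph} {S : Subset (n G)} (f : Fin (n G) → Fin (n G′)) →
                    (∀ x y → adj G′ (f x) (f y) ≡ true → adj G x y ≡ true) →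
                    IsIndependent G S → IsIndependent G′ (image f S)
image-independent {G} {G′} {S} f reflects-adj S-indep y y′ y∈ y′∈
  with x , x∈S , refl ← ∈-image⁻ f S y∈ | x′ , x′∈S , refl ← ∈-image⁻ f S y′∈ =
  ¬-not (λ fx~fx′ → contradiction (trans (sym (reflects-adj x x′ fx~fx′)) (S-indep x x′ x∈S x′∈S)) λ ())

record InducedEmbedding (X G : Graph) : Set where
  field
    ι           : Fin (n X) → Fin (n G)
    ι-injective : ∀ {a b} → ι a ≡ ι b → a ≡ b
    adj-ι       : ∀ a b → adj G (ι a) (ι b) ≡ adj X a b

module InducedEmbeddingProperties {X G : Graph} (E : InducedEmbedding X G) where
  open InducedEmbedding E

  private
    variable
      a b : Fin (n X)
      w : Fin (n G)
      e : Edge (n X)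
      M : List (Edge (n G))
      N : List (Edge (n X))

  ιᵉ : Edge (n X) → Edge (n G)
  ιᵉ (a , b) = ι a , ι b

  ι-∈ᵉ : a ∈ᵉ e → ι a ∈ᵉ ιᵉ e
  ι-∈ᵉ (inj₁ refl) = inj₁ refl
  ι-∈ᵉ (inj₂ refl) = inj₂ refl

  restrict : Subset (n G) → Subset (n X)
  restrict S = decSubset (λ a → ι a ∈ₛ? S)

  ∈-restrict⁺ : ∀ {S} → ι a ∈ₛ S → a ∈ₛ restrict S
  ∈-restrict⁺ {S = S} = ∈-decSubset⁺ (λ a → ι a ∈ₛ? S)

  ∈-restrict⁻ : ∀ {S} → a ∈ₛ restrict S → ι a ∈ₛ S
  ∈-restrict⁻ {S = S} = ∈-decSubset⁻ (λ a → ι a ∈ₛ? S)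

  restrict-independent : ∀ {S} → IsIndependent G S → IsIndependent X (restrict S)
  restrict-independent S-indep a b a∈ b∈ =
    trans (sym (adj-ι a b)) (S-indep (ι a) (ι b) (∈-restrict⁻ a∈) (∈-restrict⁻ b∈))

  preimage? : (y : Fin (n G)) → Dec (∃ λ a → ι a ≡ y)
  preimage? y = any? (λ a → ι a ≟ y)

  pullEdge : Edge (n G) → Maybe (Edge (n X))
  pullEdge (u , w) with preimage? u | preimage? w
  ... | yes (a , _) | yes (b , _) = just (a , b)
  ... | _           | _           = nothing

  pullEdge-just : ∀ f {e} → pullEdge f ≡ just e → f ≡ ιᵉ e
  pullEdge-just (u , w) eq with preimage? u | preimage? w
  pullEdge-just _ refl | yes (a , refl) | yes (b , refl) = refl
  pullEdge-just _ ()   | yes _          | no  _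
  pullEdge-just _ ()   | no  _          | _

  pullEdge-ιᵉ : ∀ e → pullEdge (ιᵉ e) ≡ just e
  pullEdge-ιᵉ (a , b) with preimage? (ι a) | preimage? (ι b)
  ... | yes (a′ , ιa′≡ιa) | yes (b′ , ιb′≡ιb) =
    cong just (cong₂ _,_ (ι-injective ιa′≡ιa) (ι-injective ιb′≡ιb))
  ... | yes _             | no  ¬b            = contradiction (b , refl) ¬b
  ... | no  ¬a            | _                 = contradiction (a , refl) ¬a

  pullback : List (Edge (n G)) → List (Edge (n X))
  pullback = mapMaybe pullEdge

  ∈-pullback⁻ : ∀ M → e ∈ pullback M → ιᵉ e ∈ M
  ∈-pullback⁻ (f ∷ M) e∈ with pullEdge f in eq
  ... | nothing = there (∈-pullback⁻ M e∈)
  ... | just _ with e∈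
  ...   | here refl = here (sym (pullEdge-just f eq))
  ...   | there e∈′ = there (∈-pullback⁻ M e∈′)

  ∈-pullback⁺ : ιᵉ e ∈ M → e ∈ pullback M
  ∈-pullback⁺ {e = e} {M = f ∷ M} (here refl) rewrite pullEdge-ιᵉ e = here refl
  ∈-pullback⁺ {M = f ∷ M} (there e∈) with pullEdge f
  ... | nothing = ∈-pullback⁺ e∈
  ... | just _  = there (∈-pullback⁺ e∈)

  ∈-endpoints-pullback : ∀ M → a ∈ endpoints (pullback M) → ι a ∈ endpoints M
  ∈-endpoints-pullback M a∈ with e , e∈ , a∈e ← ∈-endpoints⁻ (pullback M) a∈ =
    ∈-endpoints⁺ (∈-pullback⁻ M e∈) (ι-∈ᵉ a∈e)

  pullback-Unique : ∀ M → Unique (endpoints M) → Unique (endpoints (pullback M))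
  pullback-Unique []      _  = []
  pullback-Unique (f ∷ M) M! with _ ∷ _ ∷ rest! ← M! | pullEdge f in eq
  ... | nothing      = pullback-Unique M rest!
  ... | just (a , b) with refl ← pullEdge-just f eq =
    ¬Any⇒All¬ _ a∉ ∷ ¬Any⇒All¬ _ b∉ ∷ pullback-Unique M rest!
    where
    a∉ : a ∉ b ∷ endpoints (pullback M)
    a∉ (here a≡b) = endpoints-distinct {M = M} M! (cong ι a≡b)
    a∉ (there a∈) = endpoint∉rest {M = M} M! (inj₁ refl) (∈-endpoints-pullback M a∈)
    b∉ : b ∉ endpoints (pullback M)
    b∉ b∈ = endpoint∉rest {M = M} M! (inj₂ refl) (∈-endpoints-pullback M b∈)

  pullback-matching : IsMatching G M → IsMatching X (pullback M)
  pullback-matching {M = M} (M-adj , M!) =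
    All.tabulate (λ {(a , b)} e∈ → trans (sym (adj-ι a b)) (All.lookup M-adj (∈-pullback⁻ M e∈))) ,
    pullback-Unique M M!

  pullback-MatchedTo : MatchedTo M (ι a) (ι b) → MatchedTo (pullback M) a b
  pullback-MatchedTo = Sum.map ∈-pullback⁺ ∈-pullback⁺

  pullback-unmatched : Unique (endpoints M) → MatchedTo M (ι b) w → (∀ a → ι a ≢ w) →
                       b ∉ endpoints (pullback M)
  pullback-unmatched {M = M} M! b-w w∉ι b∈
    with (c , d) , cd∈ , b∈cd ← ∈-endpoints⁻ (pullback M) b∈ | b-w
  ... | inj₁ bw∈M =
    w∉ι d (cong proj₂ (matching-edge-unique M! (∈-pullback⁻ M cd∈) bw∈M (ι-∈ᵉ b∈cd) (inj₁ refl)))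
  ... | inj₂ wb∈M =
    w∉ι c (cong proj₁ (matching-edge-unique M! (∈-pullback⁻ M cd∈) wb∈M (ι-∈ᵉ b∈cd) (inj₂ refl)))

  endpoints-pushforward : (N : List (Edge (n X))) → endpoints (map ιᵉ N) ≡ map ι (endpoints N)
  endpoints-pushforward []            = refl
  endpoints-pushforward ((a , b) ∷ N) = cong (λ rest → ι a ∷ ι b ∷ rest) (endpoints-pushforward N)

  pushforward-MatchedTo : MatchedTo N a b → MatchedTo (map ιᵉ N) (ι a) (ι b)
  pushforward-MatchedTo = Sum.map (∈-map⁺ ιᵉ) (∈-map⁺ ιᵉ)

  extend-pushforward-matching : ∀ {y} → IsMatching X N → (∀ a → ι a ≢ y) → b ∉ endpoints N →
                                adj G y (ι b) ≡ true → IsMatching G ((y , ι b) ∷ map ιᵉ N)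
  extend-pushforward-matching {N = N} {b = b} {y} (N-adj , N!) y∉ι b∉N y~ιb =
    y~ιb ∷ All-map⁺ (All.map (λ {(a , a′)} a~a′ → trans (adj-ι a a′) a~a′) N-adj) ,
    ¬Any⇒All¬ _ y∉ ∷ ¬Any⇒All¬ _ ιb∉ ∷
      subst Unique (sym (endpoints-pushforward N)) (Unique.map⁺ ι-injective N!)
    where
    y∉ : y ∉ ι b ∷ endpoints (map ιᵉ N)
    y∉ (here y≡ιb) = y∉ι b (sym y≡ιb)
    y∉ (there y∈)
      with _ , _ , y≡ιa ← ∈-map⁻ ι (subst (y ∈_) (endpoints-pushforward N) y∈) = y∉ι _ (sym y≡ιa)
    ιb∉ : ι b ∉ endpoints (map ιᵉ N)
    ιb∉ ιb∈ with _ , a∈N , ιb≡ιa ← ∈-map⁻ ι (subst (ι b ∈_) (endpoints-pushforward N) ιb∈) =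
      b∉N (subst (_∈ endpoints N) (sym (ι-injective ιb≡ιa)) a∈N)

djoin : (k : ℕ) (f : Fin k → ℕ) → Σ (Fin k) (λ i → Fin (f i)) → Fin (total k f)
djoin (suc k) f (zero  , a) = a ↑ˡ total k (λ i → f (suc i))
djoin (suc k) f (suc i , a) = f zero ↑ʳ djoin k (λ i → f (suc i)) (i , a)

dsplit-djoin : ∀ k f x → dsplit k f (djoin k f x) ≡ x
dsplit-djoin (suc k) f (zero , a) rewrite splitAt-↑ˡ (f zero) a (total k (λ i → f (suc i))) = refl
dsplit-djoin (suc k) f (suc i , a)
  rewrite splitAt-↑ʳ (f zero) (total k (λ i → f (suc i))) (djoin k (λ i → f (suc i)) (i , a))
        | dsplit-djoin k (λ i → f (suc i)) (i , a) = refl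

djoin-dsplit : ∀ k f y → djoin k f (dsplit k f y) ≡ y
djoin-dsplit (suc k) f y with splitAt (f zero) y in eq
... | inj₁ a = splitAt⁻¹-↑ˡ eq
... | inj₂ b = trans (cong (f zero ↑ʳ_) (djoin-dsplit k (λ i → f (suc i)) b)) (splitAt⁻¹-↑ʳ eq)

module Corona (H : Graph) (X : Fin (n H) → Graph) where

  G : Graph
  G = corona H X

  private
    sizes : Fin (n H) → ℕ
    sizes i = n (X i)

    variable
      i j : Fin (n H)

  encode : CVert H X → Fin (n G)
  encode = join (n H) (total (n H) sizes) ∘ Sum.map₂ (djoin (n H) sizes)

  decode-encode : ∀ c → decode H X (encode c) ≡ c
  decode-encode (inj₁ i) rewrite splitAt-↑ˡ (n H) i (total (n H) sizes) = refl
  decode-encode (inj₂ x)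
    rewrite splitAt-↑ʳ (n H) (total (n H) sizes) (djoin (n H) sizes x)
          | dsplit-djoin (n H) sizes x = refl

  encode-decode : ∀ y → encode (decode H X y) ≡ y
  encode-decode y with splitAt (n H) y in eq
  ... | inj₁ _ = splitAt⁻¹-↑ˡ eq
  ... | inj₂ b = trans (cong (n H ↑ʳ_) (djoin-dsplit (n H) sizes b)) (splitAt⁻¹-↑ʳ eq)

  encode-injective : ∀ {c d} → encode c ≡ encode d → c ≡ d
  encode-injective {c} {d} eq = begin
    c                       ≡⟨ decode-encode c ⟨
    decode H X (encode c)   ≡⟨ cong (decode H X) eq ⟩
    decode H X (encode d)   ≡⟨ decode-encode d ⟩
    d                       ∎
    where open ≡-Reasoning

  inH : Fin (n H) → Fin (n G)
  inH i = encode (inj₁ i)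

  inX : (i : Fin (n H)) → Fin (n (X i)) → Fin (n G)
  inX i a = encode (inj₂ (i , a))

  data VertexView : Fin (n G) → Set where
    hub  : ∀ i → VertexView (inH i)
    leaf : ∀ i a → VertexView (inX i a)

  view : ∀ y → VertexView y
  view y = subst VertexView (encode-decode y) (view-decoded (decode H X y))
    where
    view-decoded : ∀ c → VertexView (encode c)
    view-decoded (inj₁ i)       = hub i
    view-decoded (inj₂ (i , a)) = leaf i a

  inH≢inX : ∀ {a} → inH i ≢ inX j a
  inH≢inX {i} {j} {a} eq with () ← encode-injective {inj₁ i} {inj₂ (j , a)} eq

  inX≢inH : ∀ {a} → inX i a ≢ inH j
  inX≢inH eq = inH≢inX (sym eq)

  inX-injective : ∀ {a b} → inX i a ≡ inX j b → _≡_ {A = ∃ λ i → Fin (n (X i))} (i , a) (j , b)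
  inX-injective {i} {j} {a} {b} eq with refl ← encode-injective {inj₂ (i , a)} {inj₂ (j , b)} eq = refl

  inX-injectiveʳ : ∀ {a b} → inX i a ≡ inX i b → a ≡ b
  inX-injectiveʳ eq with refl ← inX-injective eq = refl

  adj-encode : ∀ c d → adj G (encode c) (encode d) ≡ cadj H X c d
  adj-encode c d rewrite decode-encode c | decode-encode d = refl

  adj-inH-inX : ∀ i a → adj G (inH i) (inX i a) ≡ true
  adj-inH-inX i a rewrite adj-encode (inj₁ i) (inj₂ (i , a)) with i ≟ i
  ... | yes _   = refl
  ... | no  i≢i = contradiction refl i≢i

  adj-inH-inX⇒≡ : ∀ {a} → adj G (inH i) (inX j a) ≡ true → i ≡ j
  adj-inH-inX⇒≡ {i} {j} {a} i~a rewrite adj-encode (inj₁ i) (inj₂ (j , a)) with i ≟ j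
  ... | yes i≡j = i≡j
  adj-inH-inX⇒≡ () | no _

  adj-inX-inX⇒≡ : ∀ {a b} → adj G (inX i a) (inX j b) ≡ true → i ≡ j
  adj-inX-inX⇒≡ {i} {j} {a} {b} a~b rewrite adj-encode (inj₂ (i , a)) (inj₂ (j , b)) with i ≟ j
  ... | yes i≡j = i≡j
  adj-inX-inX⇒≡ () | no _

  adj-inX : ∀ i a b → adj G (inX i a) (inX i b) ≡ adj (X i) a b
  adj-inX i a b rewrite adj-encode (inj₂ (i , a)) (inj₂ (i , b)) with i ≟ i
  ... | yes refl = refl
  ... | no  i≢i  = contradiction refl i≢i

  X↪G : ∀ i → InducedEmbedding (X i) G
  X↪G i = record
    { ι           = inX i
    ; ι-injective = inX-injectiveʳ
    ; adj-ι       = adj-inX i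
    }

  private
    block-decoded : CVert H X → Fin (n H)
    block-decoded (inj₁ i)       = i
    block-decoded (inj₂ (i , _)) = i

  block : Fin (n G) → Fin (n H)
  block = block-decoded ∘ decode H X

  block-inH : ∀ i → block (inH i) ≡ i
  block-inH i = cong block-decoded (decode-encode (inj₁ i))

  block-inX : ∀ i a → block (inX i a) ≡ i
  block-inX i a = cong block-decoded (decode-encode (inj₂ (i , a)))

module ForwardDirection (H : Graph) (X : Fin (n H) → Graph) (z : ∀ i → Fin (n (X i)))
                        (W : KEWitness (corona H X)) where
  open Corona H X
  open KEWitness W

  private
    descend-decoded : CVert H X → Fin (n G)
    descend-decoded (inj₁ i)       = inX i (z i)
    descend-decoded (inj₂ (i , a)) = inX i a

  descend : Fin (n G) → Fin (n G)
  descend = descend-decoded ∘ decode H X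

  descend-inH : ∀ i → descend (inH i) ≡ inX i (z i)
  descend-inH i = cong descend-decoded (decode-encode (inj₁ i))

  descend-inX : ∀ i a → descend (inX i a) ≡ inX i a
  descend-inX i a = cong descend-decoded (decode-encode (inj₂ (i , a)))

  descend-reflects-adj : ∀ x y → adj G (descend x) (descend y) ≡ true → adj G x y ≡ true
  descend-reflects-adj x y with view x | view y
  ... | hub i | hub j rewrite descend-inH i | descend-inH j = λ zi~zj →
    case adj-inX-inX⇒≡ zi~zj of λ { refl → ⊥-elim (adj⇒≢ G zi~zj refl) }
  ... | hub i | leaf j b rewrite descend-inH i | descend-inX j b = λ zi~b →
    case adj-inX-inX⇒≡ zi~b of λ { refl → adj-inH-inX i b }
  ... | leaf i a | hub j rewrite descend-inX i a | descend-inH j = λ a~zj →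
    case adj-inX-inX⇒≡ a~zj of λ { refl → trans (adj-sym G (inX i a) (inH i)) (adj-inH-inX i a) }
  ... | leaf i a | leaf j b rewrite descend-inX i a | descend-inX j b = λ a~b → a~b

  descend-merges-adjacent : ∀ x y → descend x ≡ descend y → x ≡ y ⊎ adj G x y ≡ true
  descend-merges-adjacent x y with view x | view y
  ... | hub i | hub j rewrite descend-inH i | descend-inH j = λ eq →
    case inX-injective eq of λ { refl → inj₁ refl }
  ... | hub i | leaf j b rewrite descend-inH i | descend-inX j b = λ eq →
    case inX-injective eq of λ { refl → inj₂ (adj-inH-inX i b) }
  ... | leaf i a | hub j rewrite descend-inX i a | descend-inH j = λ eq →
    case inX-injective eq of λ { refl → inj₂ (trans (adj-sym G (inX i a) (inH i)) (adj-inH-inX i a)) }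
  ... | leaf i a | leaf j b rewrite descend-inX i a | descend-inX j b = inj₁

  descend-∉inH : ∀ x i → descend x ≢ inH i
  descend-∉inH x i with view x
  ... | hub j    rewrite descend-inH j    = inX≢inH
  ... | leaf j a rewrite descend-inX j a = inX≢inH

  S′ : Subset (n G)
  S′ = image descend S

  S′-independent : IsIndependent G S′
  S′-independent = image-independent {G} {G} descend descend-reflects-adj independent

  inH∉S′ : ∀ i → inH i ∉ₛ S′
  inH∉S′ i inH∈S′ with x , _ , descend-x≡inH ← ∈-image⁻ descend S inH∈S′ = descend-∉inH x i descend-x≡inH

  ∣S∣≤∣S′∣ : ∣ S ∣ ≤ ∣ S′ ∣
  ∣S∣≤∣S′∣ = ∣image∣≥ descend S injective-on-S
    where
    injective-on-S : ∀ {x y} → x ∈ₛ S → y ∈ₛ S → descend x ≡ descend y → x ≡ y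
    injective-on-S {x} {y} x∈S y∈S eq with descend-merges-adjacent x y eq
    ... | inj₁ x≡y = x≡y
    ... | inj₂ x~y = contradiction (trans (sym x~y) (independent x y x∈S y∈S)) λ ()

  S′-matchesInto : MatchesInto S′ M
  S′-matchesInto = tight⇒MatchesInto G S′-independent matching (begin
    n G                ≡⟨ KEWitnessProperties.tight W ⟨
    ∣ S ∣ + length M   ≤⟨ +-monoˡ-≤ (length M) ∣S∣≤∣S′∣ ⟩
    ∣ S′ ∣ + length M  ∎)
    where open ≤-Reasoning

  matched-to-leaf : ∀ v → v ∉ₛ S′ → ∃₂ λ j b → inX j b ∈ₛ S′ × MatchedTo M v (inX j b)
  matched-to-leaf v v∉S′ with S′-matchesInto v v∉S′
  ... | w , w∈S′ , v-w with view w
  ...   | hub j    = contradiction w∈S′ (inH∉S′ j)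
  ...   | leaf j b = j , b , w∈S′ , v-w

  module Fibre (i : Fin (n H)) where
    open InducedEmbeddingProperties (X↪G i)

    witness : KEWitness (X i)
    witness = record
      { S           = restrict S′
      ; M           = pullback M
      ; independent = restrict-independent S′-independent
      ; matching    = pullback-matching matching
      ; matchesInto = matchesInto′
      }
      where
      matchesInto′ : MatchesInto (restrict S′) (pullback M)
      matchesInto′ a a∉ with matched-to-leaf (inX i a) (a∉ ∘ ∈-restrict⁺)
      ... | j , b , b∈S′ , a-b with refl ← adj-inX-inX⇒≡ (MatchedTo⇒adj G matching a-b) =
        b , ∈-restrict⁺ b∈S′ , pullback-MatchedTo a-b

    ¬perfect : ¬ HasPerfectMatching (X i)
    ¬perfect with matched-to-leaf (inH i) (inH∉S′ i)
    ... | j , b , _ , hub-b with refl ← adj-inH-inX⇒≡ (MatchedTo⇒adj G matching hub-b) =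
      KEWitnessProperties.unmatched⇒¬perfect witness
        (pullback-unmatched (proj₂ matching) (MatchedTo-sym hub-b) (λ _ → inX≢inH))

module BackwardDirection (H : Graph) (X : Fin (n H) → Graph) (W : ∀ i → KEWitness (X i))
                         (x : ∀ i → Fin (n (X i)))
                         (x-unmatched : ∀ i → x i ∉ endpoints (KEWitness.M (W i))) where
  open Corona H X
  module W (i : Fin (n H)) = KEWitness (W i)
  module E (i : Fin (n H)) = InducedEmbeddingProperties (X↪G i)

  private
    S? : Decidable (λ y → ∃₂ λ i a → a ∈ₛ W.S i × inX i a ≡ y)
    S? y = any? (λ i → any? (λ a → (a ∈ₛ? W.S i) ×-dec (inX i a ≟ y)))

  S : Subset (n G)
  S = decSubset S?

  ∈-S⁺ : ∀ {i a} → a ∈ₛ W.S i → inX i a ∈ₛ S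
  ∈-S⁺ a∈ = ∈-decSubset⁺ S? (_ , _ , a∈ , refl)

  ∈-S⁻ : ∀ {y} → y ∈ₛ S → ∃₂ λ i a → a ∈ₛ W.S i × inX i a ≡ y
  ∈-S⁻ = ∈-decSubset⁻ S?

  S-independent : IsIndependent G S
  S-independent y y′ y∈ y′∈ with ∈-S⁻ y∈ | ∈-S⁻ y′∈
  ... | i , a , a∈ , refl | j , b , b∈ , refl with i ≟ j
  ...   | yes refl = trans (adj-inX i a b) (W.independent i a b a∈ b∈)
  ...   | no  i≢j  = ¬-not (i≢j ∘ adj-inX-inX⇒≡)

  star : (i : Fin (n H)) → List (Edge (n G))
  star i = (inH i , inX i (x i)) ∷ map (E.ιᵉ i) (W.M i)

  M : List (Edge (n G))
  M = concat (tabulate star)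

  ∈-star⇒∈-M : ∀ {i e} → e ∈ star i → e ∈ M
  ∈-star⇒∈-M {i} e∈ = ∈-concat⁺′ e∈ (∈-tabulate⁺ i)

  star-block : ∀ i {v} → v ∈ endpoints (star i) → block v ≡ i
  star-block i (here refl)         = block-inH i
  star-block i (there (here refl)) = block-inX i (x i)
  star-block i (there (there v∈))
    with _ , _ , refl ← ∈-map⁻ (inX i) (subst (_ ∈_) (E.endpoints-pushforward i (W.M i)) v∈) = block-inX i _

  star-matching : ∀ i → IsMatching G (star i)
  star-matching i =
    E.extend-pushforward-matching i (W.matching i) (λ _ → inX≢inH) (x-unmatched i) (adj-inH-inX i (x i))

  M-matching : IsMatching G M
  M-matching = All-concat⁺ (All-tabulate⁺ (proj₁ ∘ star-matching)) ,
               blockwise-Unique star block (proj₂ ∘ star-matching) star-block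

  M-matchesInto : MatchesInto S M
  M-matchesInto y y∉S with view y
  ... | hub i = inX i (x i) , ∈-S⁺ xᵢ∈Sᵢ , inj₁ (∈-star⇒∈-M (here refl))
    where
    xᵢ∈Sᵢ : x i ∈ₛ W.S i
    xᵢ∈Sᵢ = KEWitnessProperties.unmatched⇒∈ (W i) (x-unmatched i)
  ... | leaf i a with b , b∈ , a-b ← W.matchesInto i a (y∉S ∘ ∈-S⁺) =
    inX i b , ∈-S⁺ b∈ , Sum.map (∈-star⇒∈-M ∘ there) (∈-star⇒∈-M ∘ there) (E.pushforward-MatchedTo i a-b)

  witness : KEWitness G
  witness = record
    { S = S ; M = M ; independent = S-independent ; matching = M-matching ; matchesInto = M-matchesInto }

theorem2p2 : (H : Graph) (X : Fin (n H) → Graph) →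
    (∀ i → n (X i) ≥ 1) →
    IsKE (corona H X) ⇔ (∀ i → IsKE (X i) × ¬ HasPerfectMatching (X i))
theorem2p2 H X nonempty = mk⇔ forward backward
  where
  forward : IsKE (corona H X) → ∀ i → IsKE (X i) × ¬ HasPerfectMatching (X i)
  forward ke i = KEWitnessProperties.isKE witness , ¬perfect
    where open ForwardDirection.Fibre H X (λ i → fromℕ< (nonempty i)) (IsKE⇒KEWitness _ ke) i

  backward : (∀ i → IsKE (X i) × ¬ HasPerfectMatching (X i)) → IsKE (corona H X)
  backward X-KE = KEWitnessProperties.isKE (BackwardDirection.witness H X W x x-unmatched)
    where
    W : ∀ i → KEWitness (X i)
    W i = IsKE⇒KEWitness (X i) (proj₁ (X-KE i))
    free : ∀ i → ∃ λ v → v ∉ endpoints (KEWitness.M (W i))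
    free i = KEWitnessProperties.¬perfect⇒unmatched (W i) (proj₂ (X-KE i))
    x : ∀ i → Fin (n (X i))
    x = proj₁ ∘ free
    x-unmatched : ∀ i → x i ∉ endpoints (KEWitness.M (W i))
    x-unmatched = proj₂ ∘ free
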